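{- Let $I=(G,D,\mathsf{cost},\mathsf{supply},\mathsf{demand})$ be an instance of Min Weight Generalized Domination, let $R\subseteq V(I)$ and $S=N(R)$. Assume $\phi$ is a correct solution to $I$ and $\psi\in\prod_{u\in R}D_u$ is locally correct on $R$ with $\mathsf{interaction}_{R,S}(\phi|_R)=\mathsf{interaction}_{R,S}(\psi)$. Then the valuation $\phi'$ given by $\phi'(u)=\psi(u)$ for $u\in R$ and $\phi'(u)=\phi(u)$ for $u\notin R$ is also a correct solution to $I$.
   Context: Multigraphs may have parallel edges (distinguished) but no loops; $\delta(u)$ is the set of edges incident to $u$; $E(A,B)$ is the set of edges with one endpoint in $A$ and the other in $B$; $N(R)$ is the set of vertices outside $R$ adjacent to $R$. An instance of Min Weight Generalized Domination consists of a multigraph $G$ and for each vertex $u$ a finite domain $D_u$, a cost function $\mathsf{cost}_u:D_u\to\mathbb{R}_{\ge0}\cup\{+\infty\}$, and $\mathsf{supply}_u,\mathsf{demand}_u:D_u\to2^{\delta(u)}$. A (correct) solution is $\phi$ with $\phi(u)\in D_u$ such that for every edge $e$ with endpoints $u,v$, $e\in\mathsf{demand}_u(\phi(u))\Rightarrow e\in\mathsf{supply}_v(\phi(v))$ and $e\in\mathsf{demand}_v(\phi(v))\Rightarrow e\in\mathsf{supply}_u(\phi(u))$. A valuation $\phi\in\prod_{u\in A}D_u$ is locally correct on $A$ if for every edge $e$ with both endpoints $u,v\in A$, $e\in\mathsf{demand}_u(\phi(u))$ implies $e\in\mathsf{supply}_v(\phi(v))$. For $\phi\in\prod_{u\in R}D_u$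 and $S=N(R)$, $\mathsf{interaction}_{R,S}(\phi)$ is the function $x$ on $E(R,S)$ with values in subsets of $\{\mathsf{Supply},\mathsf{Demand}\}$ such that for $e=uv$, $u\in R$, $v\in S$: $\mathsf{Supply}\in x(e)$ iff $e\in\mathsf{supply}_u(\phi(u))$, and $\mathsf{Demand}\in x(e)$ iff $e\in\mathsf{demand}_u(\phi(u))$. -}

module Defs where

open import Data.Nat using (ℕ)
open import Data.Fin using (Fin)
open import Data.Fin.Subset using (Subset; _∈_; _∉_)
open import Data.Fin.Subset.Properties using (_∈?_)
open import Data.Bool using (Bool)
open import Data.Product using (Σ; ∃; _×_; _,_; proj₁; proj₂)
open import Data.Sum using (_⊎_; inj₁; inj₂)
open import Relation.Binary.PropositionalEquality using (_≡_; _≢_)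
open import Relation.Nullary using (does; yes; no)

record Multigraph (n m : ℕ) : Set where
  field
    end₁ end₂ : Fin m → Fin n
    noLoop    : ∀ e → end₁ e ≢ end₂ e

  Incident : Fin m → Fin n → Set
  Incident e u = (u ≡ end₁ e) ⊎ (u ≡ end₂ e)

open Multigraph public

-- An instance of Min Weight Generalized Domination (costs omitted: they play
-- no role in the notion of a correct solution).
-- Domains are finite: D_u = Fin (dsize u).
record Instance (n m : ℕ) : Set where
  field
    G       : Multigraph n m
    dsize   : Fin n → ℕ
    supply  : (u : Fin n) → Fin (dsize u) → Subset m
    demand  : (u : Fin n) → Fin (dsize u) → Subset m
    supply⊆δ : ∀ u d e → e ∈ supply u d → Incident G e u
    demand⊆δ : ∀ u d e → e ∈ demand u d → Incident G e u

  D : Fin n → Set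
  D u = Fin (dsize u)

open Instance public

module _ {n m : ℕ} (I : Instance n m) where

  Valuation : Set
  Valuation = (u : Fin n) → D I u

  PartialVal : Subset n → Set
  PartialVal A = (u : Fin n) → u ∈ A → D I u

  Correct : Valuation → Set
  Correct φ = ∀ e →
    let a = end₁ (G I) e ; b = end₂ (G I) e in
    (e ∈ demand I a (φ a) → e ∈ supply I b (φ b)) ×
    (e ∈ demand I b (φ b) → e ∈ supply I a (φ a))

  LocallyCorrect : (A : Subset n) → PartialVal A → Set
  LocallyCorrect A ψ = ∀ e →
    (pa : end₁ (G I) e ∈ A) → (pb : end₂ (G I) e ∈ A) →
    (e ∈ demand I _ (ψ _ pa) → e ∈ supply I _ (ψ _ pb)) ×
    (e ∈ demand I _ (ψ _ pb) → e ∈ supply I _ (ψ _ pa))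

  Nbhd : Subset n → Fin n → Set
  Nbhd R v = v ∉ R × ∃ λ e →
    (end₁ (G I) e ∈ R × v ≡ end₂ (G I) e) ⊎ (end₂ (G I) e ∈ R × v ≡ end₁ (G I) e)

  EdgeBetween : Subset n → (Fin n → Set) → Fin m → Set
  EdgeBetween A B e =
    (end₁ (G I) e ∈ A × B (end₂ (G I) e)) ⊎ (end₂ (G I) e ∈ A × B (end₁ (G I) e))

  -- x(e) ⊆ {Supply, Demand} encoded as (Supply ∈ x(e) , Demand ∈ x(e)) : Bool × Bool
  interaction : (R : Subset n) → PartialVal R →
                (e : Fin m) → EdgeBetween R (Nbhd R) e → Bool × Bool
  interaction R ψ e (inj₁ (pu , _)) =
    does (e ∈? supply I _ (ψ _ pu)) , does (e ∈? demand I _ (ψ _ pu))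
  interaction R ψ e (inj₂ (pu , _)) =
    does (e ∈? supply I _ (ψ _ pu)) , does (e ∈? demand I _ (ψ _ pu))

  restrict : (R : Subset n) → Valuation → PartialVal R
  restrict R φ u _ = φ u

  override : (R : Subset n) → Valuation → PartialVal R → Valuation
  override R φ ψ u with u ∈? R
  ... | yes p = ψ u p
  ... | no _  = φ u

-- Only edges with an endpoint in R change their valuation. Edges inside R are
-- handled by local correctness of ψ and edges outside R by correctness of φ.
-- An edge between R and N(R) keeps its outer endpoint, and its inner endpoint
-- has the same supply/demand status on that edge under φ and ψ, which is
-- exactly what equality of the interactions records.
module Submission where

open import Defs
open import Data.Nat using (ℕ)
open import Data.Fin using (Fin)
open import Data.Fin.Subset using (Subset; _∈_; _∉_)
open import Data.Fin.Subset.Properties using (_∈?_)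
open import Data.Bool using (Bool)
open import Data.Product using (_×_; _,_; proj₁; proj₂)
open import Data.Sum using (inj₁; inj₂)
open import Data.Vec.Properties.WithK using ([]=-irrelevant)
open import Relation.Binary.PropositionalEquality
  using (_≡_; refl; sym; trans; cong; subst₂)
open import Relation.Nullary using (Dec; does; yes; no; contradiction)
open import Relation.Nullary.Decidable using (dec-true)

same-does⇒implies : {P Q : Set} (P? : Dec P) (Q? : Dec Q) →
                    does P? ≡ does Q? → P → Q
same-does⇒implies P? (yes q) _  _ = q
same-does⇒implies P? (no ¬q) eq p = contradiction (trans (sym (dec-true P? p)) eq) λ ()

module EdgeCondition {n m : ℕ} (I : Instance n m) where

  -- On an edge of E(R, N(R)), interaction is definitionally the signature of its endpoint in R.
  signature : (u : Fin n) → D I u → Fin m → Bool × Bool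
  signature u d e = does (e ∈? supply I u d) , does (e ∈? demand I u d)

  EdgeCorrect : (e : Fin m) → D I (end₁ (G I) e) → D I (end₂ (G I) e) → Set
  EdgeCorrect e x y =
    (e ∈ demand I _ x → e ∈ supply I _ y) × (e ∈ demand I _ y → e ∈ supply I _ x)

  module _ {e : Fin m} where

    supply-transport : ∀ {u} {d d′ : D I u} →
                       signature u d e ≡ signature u d′ e →
                       e ∈ supply I u d → e ∈ supply I u d′
    supply-transport eq = same-does⇒implies (_ ∈? _) (_ ∈? _) (cong proj₁ eq)

    demand-transport : ∀ {u} {d d′ : D I u} →
                       signature u d e ≡ signature u d′ e →
                       e ∈ demand I u d → e ∈ demand I u d′
    demand-transport eq = same-does⇒implies (_ ∈? _) (_ ∈? _) (cong proj₂ eq)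

    EdgeCorrect-subst : ∀ {x x′ y y′} → x ≡ x′ → y ≡ y′ →
                        EdgeCorrect e x′ y′ → EdgeCorrect e x y
    EdgeCorrect-subst x≡x′ y≡y′ = subst₂ (EdgeCorrect e) (sym x≡x′) (sym y≡y′)

    EdgeCorrect-respˡ : ∀ {x x′ y} → signature _ x e ≡ signature _ x′ e →
                        EdgeCorrect e x y → EdgeCorrect e x′ y
    EdgeCorrect-respˡ eq (x⇒y , y⇒x) =
      (λ d → x⇒y (demand-transport (sym eq) d)) , (λ d → supply-transport eq (y⇒x d))

    EdgeCorrect-respʳ : ∀ {x y y′} → signature _ y e ≡ signature _ y′ e →
                        EdgeCorrect e x y → EdgeCorrect e x y′
    EdgeCorrect-respʳ eq (x⇒y , y⇒x) =
      (λ d → supply-transport eq (x⇒y d)) , (λ d → y⇒x (demand-transport (sym eq) d))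

  module Override (R : Subset n) (φ : Valuation I) (ψ : PartialVal I R) where

    override-∈ : ∀ {u} (p : u ∈ R) → override I R φ ψ u ≡ ψ u p
    override-∈ {u} p with u ∈? R
    ... | yes q = cong (ψ u) ([]=-irrelevant q p)
    ... | no ¬p = contradiction p ¬p

    override-∉ : ∀ {u} → u ∉ R → override I R φ ψ u ≡ φ u
    override-∉ {u} ¬p with u ∈? R
    ... | yes p = contradiction p ¬p
    ... | no _  = refl

    SameInteraction : Set
    SameInteraction = ∀ e p → interaction I R (restrict I R φ) e p ≡ interaction I R ψ e p

    SameInteraction⇒signature₁ : SameInteraction → ∀ {e} (pa : end₁ (G I) e ∈ R) →
                                 end₂ (G I) e ∉ R →
                                 signature _ (φ _) e ≡ signature _ (ψ _ pa) e
    SameInteraction⇒signature₁ same {e} pa ¬pb =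
      same e (inj₁ (pa , ¬pb , e , inj₁ (pa , refl)))

    SameInteraction⇒signature₂ : SameInteraction → ∀ {e} (pb : end₂ (G I) e ∈ R) →
                                 end₁ (G I) e ∉ R →
                                 signature _ (φ _) e ≡ signature _ (ψ _ pb) e
    SameInteraction⇒signature₂ same {e} pb ¬pa =
      same e (inj₂ (pb , ¬pa , e , inj₂ (pb , refl)))

lemma28 : {n m : ℕ} (I : Instance n m) (R : Subset n)
          (φ : Valuation I) (ψ : PartialVal I R) →
          Correct I φ →
          LocallyCorrect I R ψ →
          (∀ e p → interaction I R (restrict I R φ) e p ≡ interaction I R ψ e p) →
          Correct I (override I R φ ψ)
lemma28 I R φ ψ φ-correct ψ-local same e = by-cases (end₁ (G I) e ∈? R) (end₂ (G I) e ∈? R)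
  where
  open EdgeCondition I
  open Override R φ ψ
  φ′ : Valuation I
  φ′ = override I R φ ψ

  by-cases : Dec (end₁ (G I) e ∈ R) → Dec (end₂ (G I) e ∈ R) →
             EdgeCorrect e (φ′ (end₁ (G I) e)) (φ′ (end₂ (G I) e))
  by-cases (yes pa) (yes pb) =
    EdgeCorrect-subst (override-∈ pa) (override-∈ pb) (ψ-local e pa pb)
  by-cases (yes pa) (no ¬pb) =
    EdgeCorrect-subst (override-∈ pa) (override-∉ ¬pb)
      (EdgeCorrect-respˡ (SameInteraction⇒signature₁ same pa ¬pb) (φ-correct e))
  by-cases (no ¬pa) (yes pb) =
    EdgeCorrect-subst (override-∉ ¬pa) (override-∈ pb)
      (EdgeCorrect-respʳ (SameInteraction⇒signature₂ same pb ¬pa) (φ-correct e))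
  by-cases (no ¬pa) (no ¬pb) =
    EdgeCorrect-subst (override-∉ ¬pa) (override-∉ ¬pb) (φ-correct e)
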